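{- Let $n\ge2$, ${\cal I}=\{(i,j)\mid 1\le i\le n,\ 1\le j\le n+1\}$ and $S=\{(i,j)\in{\cal I}\mid i+j\le n+1\}$. Let $X\ne Y$ be tables in the same fiber and $Z=(z_{ij})=X-Y$. If there is a row $i_a$ such that one of $z_{i_a1}$, $z_{i_a,n+1}$ is strictly positive and the other is strictly negative, then $\Vert X-Y\Vert_1$ can be reduced by ${\cal B}_0(S)$.
   Context: A table is an array on ${\cal I}$ with entries in $\mathbb{N}=\{0,1,\dots\}$; the fiber of $X$ is the set of tables with the same row sums, column sums and sum of entries over $S$. For $i\ne i'$, $j\ne j'$, the basic move $B(i,i';j,j')$ has $+1$ at $(i,j),(i',j')$, $-1$ at $(i,j'),(i',j)$, $0$ elsewhere; ${\cal B}_0(S)$ is the set of basic moves whose entries over $S$ sum to $0$. $\Vert W\Vert_1=\sum|w_{ij}|$. For $X\ne Y$ in the same fiber ${\cal F}$, $\Vert X-Y\Vert_1$ can be reduced by ${\cal B}_0(S)$ if there exist $\tau^+,\tau^-\ge0$, $\tau^++\tau^->0$, and $B^+_1,\dots,B^+_{\tau^+},B^-_1,\dots,B^-_{\tau^- }\in{\cal B}_0(S)$ with $X+\sum_{t=1}^{\tau'}B^+_t\in{\cal F}$ ($\tau'=1,\dots,\tau^+$), $Y-\sum_{t=1}^{\tau'}B^-_t\in{\cal F}$ ($\tau'=1,\dots,\tau^-$), and $\Vert X-Y+\sum_t B^+_t+\sum_t B^-_t\Vert_1<\Vert X-Y\Vert_1$. -}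

module Defs where

open import Data.Nat using (ℕ; zero; suc; _<_; _≤_)
open import Data.Fin using (Fin; toℕ; fromℕ) renaming (zero to fzero)
import Data.Fin as F
open import Data.Integer as ℤ using (ℤ; +_; ∣_∣) renaming (_+_ to _+ℤ_; _-_ to _-ℤ_)
open import Data.List using (List; []; _∷_; length; take)
open import Data.List.Relation.Unary.All using (All)
open import Data.Bool using (Bool; true; false; if_then_else_; _∧_)
open import Data.Product using (Σ; _×_; ∃; ∃-syntax)
open import Relation.Nullary using (¬_; does)
open import Relation.Binary.PropositionalEquality using (_≡_; _≢_)

sumFin : {A : Set} → (A → A → A) → A → (m : ℕ) → (Fin m → A) → A
sumFin _⊕_ e zero    f = e
sumFin _⊕_ e (suc m) f = f fzero ⊕ sumFin _⊕_ e m (λ k → f (F.suc k))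

Σℤ : (m : ℕ) → (Fin m → ℤ) → ℤ
Σℤ = sumFin _+ℤ_ (+ 0)

Σℕ : (m : ℕ) → (Fin m → ℕ) → ℕ
Σℕ = sumFin Data.Nat._+_ 0

-- Index set I = {1..n} × {1..n+1}, encoded 0-based as Fin n × Fin (suc n).
-- A table (entries in ℕ) and an integer array on I.
Table : ℕ → Set
Table n = Fin n → Fin (suc n) → ℕ

Array : ℕ → Set
Array n = Fin n → Fin (suc n) → ℤ

-- S = {(i,j) | i + j ≤ n+1} (1-based); 0-based: toℕ i + toℕ j + 2 ≤ n + 1,
-- i.e. toℕ i + toℕ j < n.
inS? : {n : ℕ} → Fin n → Fin (suc n) → Bool
inS? {n} i j = does (Data.Nat._<?_ (toℕ i Data.Nat.+ toℕ j) n)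

rowSum : {n : ℕ} → Array n → Fin n → ℤ
rowSum {n} A i = Σℤ (suc n) (λ j → A i j)

colSum : {n : ℕ} → Array n → Fin (suc n) → ℤ
colSum {n} A j = Σℤ n (λ i → A i j)

sSum : {n : ℕ} → Array n → ℤ
sSum {n} A = Σℤ n (λ i → Σℤ (suc n) (λ j → if inS? i j then A i j else + 0))

toArray : {n : ℕ} → Table n → Array n
toArray T i j = + (T i j)

_⊞_ : {n : ℕ} → Array n → Array n → Array n
(A ⊞ B) i j = A i j +ℤ B i j

_⊟_ : {n : ℕ} → Array n → Array n → Array n
(A ⊟ B) i j = A i j -ℤ B i j

zeroA : {n : ℕ} → Array n
zeroA i j = + 0

SameFiber : {n : ℕ} → Table n → Table n → Set
SameFiber {n} X T =
  (∀ i → rowSum (toArray X) i ≡ rowSum (toArray T) i) ×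
  (∀ j → colSum (toArray X) j ≡ colSum (toArray T) j) ×
  (sSum (toArray X) ≡ sSum (toArray T))

InFiberOf : {n : ℕ} → Table n → Array n → Set
InFiberOf {n} X A = Σ (Table n) λ T → (∀ i j → toArray T i j ≡ A i j) × SameFiber X T

record BasicMove (n : ℕ) : Set where
  constructor bm
  field
    i i' : Fin n
    j j' : Fin (suc n)
    i≢i' : i ≢ i'
    j≢j' : j ≢ j'

moveArray : {n : ℕ} → BasicMove n → Array n
moveArray (bm i i' j j' _ _) a b =
  if (does (a F.≟ i) ∧ does (b F.≟ j)) then + 1 else
  if (does (a F.≟ i') ∧ does (b F.≟ j')) then + 1 else
  if (does (a F.≟ i) ∧ does (b F.≟ j')) then ℤ.-[1+ 0 ] else
  if (does (a F.≟ i') ∧ does (b F.≟ j)) then ℤ.-[1+ 0 ] else + 0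

InB0 : {n : ℕ} → BasicMove n → Set
InB0 B = sSum (moveArray B) ≡ + 0

sumMoves : {n : ℕ} → List (BasicMove n) → Array n
sumMoves []       = zeroA
sumMoves (B ∷ Bs) = moveArray B ⊞ sumMoves Bs

norm1 : {n : ℕ} → Array n → ℕ
norm1 {n} W = Σℕ n (λ i → Σℕ (suc n) (λ j → ∣ W i j ∣))

-- ‖X − Y‖₁ can be reduced by B₀(S)  (X, Y in the same fiber F; F = fiber of X).
Reducible : {n : ℕ} → Table n → Table n → Set
Reducible {n} X Y =
  Σ (List (BasicMove n)) λ Bp → Σ (List (BasicMove n)) λ Bm →
    (0 < length Bp Data.Nat.+ length Bm) ×
    All InB0 Bp × All InB0 Bm ×
    (∀ k → 1 ≤ k → k ≤ length Bp → InFiberOf X (toArray X ⊞ sumMoves (take k Bp))) ×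
    (∀ k → 1 ≤ k → k ≤ length Bm → InFiberOf X (toArray Y ⊟ sumMoves (take k Bm))) ×
    (norm1 (((toArray X ⊟ toArray Y) ⊞ sumMoves Bp) ⊞ sumMoves Bm)
       < norm1 (toArray X ⊟ toArray Y))

-- Say z(p,1) > 0 > z(p,n+1); the other case is symmetric. Column n+1 of Z = X - Y sums to 0,
-- so z(q,n+1) > 0 for some row q. The basic move B(p,q;n+1,1) lies in B₀(S) because column 1
-- lies inside S and column n+1 outside it, so rows p and q meet S in the same columns of the
-- move. Adding it to X subtracts 1 only where X > Y, so X stays a table, and it lowers |z| by 1
-- at (p,1), (p,n+1) and (q,n+1) while raising it by at most 1 at (q,1).

module Submission where

open import Defs
open import Data.Nat using (ℕ; suc; _≤_)
open import Data.Fin using (Fin; fromℕ) renaming (zero to fzero)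
open import Data.Integer using (ℤ; +_) renaming (_<_ to _<ℤ_)
open import Data.Product using (Σ; _×_)
open import Data.Sum using (_⊎_)
open import Relation.Nullary using (¬_)
open import Relation.Binary.PropositionalEquality using (_≡_)

import Data.Nat as ℕ
import Data.Nat.Properties as ℕ
open import Data.Fin using (_≟_; punchIn; toℕ) renaming (suc to fsuc)
open import Data.Fin.Properties using (punchInᵢ≢i; ¬∀⟶∃¬; toℕ<n; toℕ-fromℕ)
open import Data.Integer
  using (0ℤ; 1ℤ; -1ℤ; +0; _+_; _-_; _*_; -_; +≤+; +<+; -[1+_]; +[1+_]; ∣_∣)
  renaming (_≤_ to _≤ℤ_)
import Data.Integer.Properties as ℤ
open import Data.Bool using (Bool; true; false; if_then_else_)
open import Data.Empty using (⊥-elim)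
open import Data.List using (List; []; _∷_; take)
open import Data.List.Relation.Unary.All using (All; []; _∷_)
open import Data.Product using (_,_; proj₁)
open import Data.Sum using (inj₁; inj₂)
open import Function using (_∘_)
open import Relation.Nullary using (does; yes; no)
open import Relation.Nullary.Decidable using (dec-true; dec-false)
open import Relation.Binary.PropositionalEquality
  using (refl; sym; trans; cong; cong₂; subst; _≢_; module ≡-Reasoning)
open import Algebra.Properties.Semiring.Sum ℤ.+-*-semiring
  using (sum; sum-cong-≗; ∑-distrib-+; sum-remove; sum-replicate-zero; *-distribˡ-sum)

Σℤ≡sum : ∀ m (f : Fin m → ℤ) → Σℤ m f ≡ sum f
Σℤ≡sum ℕ.zero  f = refl
Σℤ≡sum (suc m) f = cong (_+_ (f fzero)) (Σℤ≡sum m (f ∘ fsuc))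

+Σℕ≡sum : ∀ m (f : Fin m → ℕ) → + Σℕ m f ≡ sum (λ k → + f k)
+Σℕ≡sum ℕ.zero  f = refl
+Σℕ≡sum (suc m) f = trans (ℤ.pos-+ (f fzero) _) (cong (_+_ (+ f fzero)) (+Σℕ≡sum m (f ∘ fsuc)))

sum-neg : ∀ {m} (f : Fin m → ℤ) → sum (λ k → - f k) ≡ - sum f
sum-neg {ℕ.zero}  f = refl
sum-neg {suc m} f =
  trans (cong (_+_ (- f fzero)) (sum-neg (f ∘ fsuc))) (sym (ℤ.neg-distrib-+ (f fzero) _))

∑-mono-≤ : ∀ {m} {f g : Fin m → ℤ} → (∀ k → f k ≤ℤ g k) → sum f ≤ℤ sum g
∑-mono-≤ {ℕ.zero}  f≤g = ℤ.≤-refl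
∑-mono-≤ {suc m} f≤g = ℤ.+-mono-≤ (f≤g fzero) (∑-mono-≤ (f≤g ∘ fsuc))

∑-mono-< : ∀ {m} {f g : Fin m → ℤ} → (∀ k → f k ≤ℤ g k) → ∀ k₀ → f k₀ <ℤ g k₀ → sum f <ℤ sum g
∑-mono-< f≤g fzero      f<g = ℤ.+-mono-<-≤ f<g (∑-mono-≤ (f≤g ∘ fsuc))
∑-mono-< f≤g (fsuc k₀) f<g = ℤ.+-mono-≤-< (f≤g fzero) (∑-mono-< (f≤g ∘ fsuc) k₀ f<g)

∃-positive-of-∑≡0 : ∀ {m} (f : Fin m → ℤ) → sum f ≡ 0ℤ → ∀ k₀ → f k₀ <ℤ 0ℤ → Σ (Fin m) λ k → 0ℤ <ℤ f k
∃-positive-of-∑≡0 {m} f ∑f≡0 k₀ fk₀<0 with ¬∀⟶∃¬ m (λ k → f k ≤ℤ 0ℤ) (λ k → f k ℤ.≤? 0ℤ) all-nonpositive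
  where
  all-nonpositive : ¬ (∀ k → f k ≤ℤ 0ℤ)
  all-nonpositive f≤0 = ℤ.<-irrefl (trans ∑f≡0 (sym (sum-replicate-zero m))) (∑-mono-< f≤0 k₀ fk₀<0)
... | k , fk≰0 = k , ℤ.≰⇒> fk≰0

0<x-y⇒0≤x-1 : ∀ x y → 0ℤ <ℤ + x - + y → 0ℤ ≤ℤ + x - 1ℤ
0<x-y⇒0≤x-1 ℕ.zero    ℕ.zero  (+<+ ())
0<x-y⇒0≤x-1 ℕ.zero    (suc y) ()
0<x-y⇒0≤x-1 (suc x) y       _ = +≤+ ℕ.z≤n

∣i+1∣≤∣i∣+1 : ∀ i → + ∣ i + 1ℤ ∣ ≤ℤ + ∣ i ∣ + 1ℤ
∣i+1∣≤∣i∣+1 i = +≤+ (ℤ.∣i+j∣≤∣i∣+∣j∣ i 1ℤ)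

i<0⇒∣i+1∣<∣i∣+1 : ∀ {i} → i <ℤ 0ℤ → + ∣ i + 1ℤ ∣ <ℤ + ∣ i ∣ + 1ℤ
i<0⇒∣i+1∣<∣i∣+1 { + _ }          (+<+ ())
i<0⇒∣i+1∣<∣i∣+1 { -[1+ ℕ.zero ]} _ = +<+ (ℕ.s≤s ℕ.z≤n)
i<0⇒∣i+1∣<∣i∣+1 { -[1+ suc k ]}  _ = +<+ (ℕ.<-≤-trans (ℕ.n<1+n (suc k)) (ℕ.m≤m+n (suc (suc k)) 1))

0<i⇒∣i-1∣≡∣i∣-1 : ∀ {i} → 0ℤ <ℤ i → + ∣ i - 1ℤ ∣ ≡ + ∣ i ∣ - 1ℤ
0<i⇒∣i-1∣≡∣i∣-1 { +0 }      (+<+ ())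
0<i⇒∣i-1∣≡∣i∣-1 { +[1+ k ]} _ = refl

∣i+0∣≡∣i∣+0 : ∀ i → + ∣ i + 0ℤ ∣ ≡ + ∣ i ∣ + 0ℤ
∣i+0∣≡∣i∣+0 i = trans (cong (+_ ∘ ∣_∣) (ℤ.+-identityʳ i)) (sym (ℤ.+-identityʳ (+ ∣ i ∣)))

δ : ∀ {m} → Fin m → Fin m → ℤ
δ x a = if does (a ≟ x) then 1ℤ else 0ℤ

δ-refl : ∀ {m} (x : Fin m) → δ x x ≡ 1ℤ
δ-refl x = cong (if_then 1ℤ else 0ℤ) (dec-true (x ≟ x) refl)

δ-≢ : ∀ {m} {x a : Fin m} → a ≢ x → δ x a ≡ 0ℤ
δ-≢ {x = x} {a} a≢x = cong (if_then 1ℤ else 0ℤ) (dec-false (a ≟ x) a≢x)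

∑-δ* : ∀ {m} (x : Fin m) (f : Fin m → ℤ) → sum (λ a → δ x a * f a) ≡ f x
∑-δ* {suc m} x f = begin
  sum (λ a → δ x a * f a)
    ≡⟨ sum-remove {i = x} (λ a → δ x a * f a) ⟩
  δ x x * f x + sum (λ k → δ x (punchIn x k) * f (punchIn x k))
    ≡⟨ cong₂ _+_ (trans (cong (_* f x) (δ-refl x)) (ℤ.*-identityˡ (f x)))
                 (trans (sum-cong-≗ λ k → cong (_* f (punchIn x k)) (δ-≢ (punchInᵢ≢i x k)))
                        (sum-replicate-zero m)) ⟩
  f x + 0ℤ
    ≡⟨ ℤ.+-identityʳ (f x) ⟩
  f x ∎
  where open ≡-Reasoning

Δ : ∀ {m} → Fin m → Fin m → Fin m → ℤ
Δ x x' a = δ x a - δ x' a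

Δ-first : ∀ {m} {x x' : Fin m} → x ≢ x' → Δ x x' x ≡ 1ℤ
Δ-first {x = x} x≢x' = cong₂ _-_ (δ-refl x) (δ-≢ x≢x')

data Δ-Value {m} (x x' a : Fin m) : ℤ → Set where
  first  : a ≡ x  → Δ-Value x x' a 1ℤ
  second : a ≡ x' → Δ-Value x x' a -1ℤ
  other  : Δ-Value x x' a 0ℤ

Δ-value : ∀ {m} {x x' : Fin m} → x ≢ x' → ∀ a → Δ-Value x x' a (Δ x x' a)
Δ-value {x = x} {x'} x≢x' a with a ≟ x | a ≟ x'
... | yes refl | yes refl = ⊥-elim (x≢x' refl)
... | yes refl | no _     = first refl
... | no _     | yes refl = second refl
... | no _     | no _     = other

∑-Δ* : ∀ {m} (x x' : Fin m) (f : Fin m → ℤ) → sum (λ a → Δ x x' a * f a) ≡ f x - f x'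
∑-Δ* x x' f = begin
  sum (λ a → Δ x x' a * f a)
    ≡⟨ sum-cong-≗ (λ a → distrib (δ x a) (δ x' a) (f a)) ⟩
  sum (λ a → δ x a * f a + - (δ x' a * f a))
    ≡⟨ ∑-distrib-+ (λ a → δ x a * f a) (λ a → - (δ x' a * f a)) ⟩
  sum (λ a → δ x a * f a) + sum (λ a → - (δ x' a * f a))
    ≡⟨ cong₂ _+_ (∑-δ* x f) (trans (sum-neg (λ a → δ x' a * f a)) (cong -_ (∑-δ* x' f))) ⟩
  f x - f x' ∎
  where
  open ≡-Reasoning
  distrib : ∀ u v w → (u - v) * w ≡ u * w + - (v * w)
  distrib u v w = trans (ℤ.*-distribʳ-+ w u (- v)) (cong (_+_ (u * w)) (sym (ℤ.neg-distribˡ-* v w)))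

∑-Δ : ∀ {m} (x x' : Fin m) → sum (Δ x x') ≡ 0ℤ
∑-Δ x x' = trans (sum-cong-≗ (λ a → sym (ℤ.*-identityʳ (Δ x x' a)))) (∑-Δ* x x' (λ _ → 1ℤ))

module _ {n : ℕ} where

  _∣S : Array n → Array n
  (A ∣S) i j = if inS? i j then A i j else 0ℤ

  rowSum≡sum : ∀ (A : Array n) i → rowSum A i ≡ sum (A i)
  rowSum≡sum A i = Σℤ≡sum (suc n) (A i)

  colSum≡sum : ∀ (A : Array n) j → colSum A j ≡ sum (λ i → A i j)
  colSum≡sum A j = Σℤ≡sum n (λ i → A i j)

  sSum≡sum : ∀ (A : Array n) → sSum A ≡ sum (λ i → sum ((A ∣S) i))
  sSum≡sum A = trans (Σℤ≡sum n _) (sum-cong-≗ (λ i → Σℤ≡sum (suc n) ((A ∣S) i)))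

  rowSum-cong : {A B : Array n} → (∀ i j → A i j ≡ B i j) → ∀ i → rowSum A i ≡ rowSum B i
  rowSum-cong {A} {B} A≗B i =
    trans (rowSum≡sum A i) (trans (sum-cong-≗ (A≗B i)) (sym (rowSum≡sum B i)))

  colSum-cong : {A B : Array n} → (∀ i j → A i j ≡ B i j) → ∀ j → colSum A j ≡ colSum B j
  colSum-cong {A} {B} A≗B j =
    trans (colSum≡sum A j) (trans (sum-cong-≗ (λ i → A≗B i j)) (sym (colSum≡sum B j)))

  sSum-cong : {A B : Array n} → (∀ i j → A i j ≡ B i j) → sSum A ≡ sSum B
  sSum-cong {A} {B} A≗B = trans (sSum≡sum A) (trans
    (sum-cong-≗ (λ i → sum-cong-≗ (λ j → cong (if inS? i j then_else 0ℤ) (A≗B i j))))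
    (sym (sSum≡sum B)))

  rowSum-⊞ : ∀ (A B : Array n) i → rowSum (A ⊞ B) i ≡ rowSum A i + rowSum B i
  rowSum-⊞ A B i = trans (rowSum≡sum (A ⊞ B) i)
    (trans (∑-distrib-+ (A i) (B i)) (sym (cong₂ _+_ (rowSum≡sum A i) (rowSum≡sum B i))))

  colSum-⊞ : ∀ (A B : Array n) j → colSum (A ⊞ B) j ≡ colSum A j + colSum B j
  colSum-⊞ A B j = trans (colSum≡sum (A ⊞ B) j)
    (trans (∑-distrib-+ (λ i → A i j) (λ i → B i j)) (sym (cong₂ _+_ (colSum≡sum A j) (colSum≡sum B j))))

  colSum-⊟ : ∀ (A B : Array n) j → colSum (A ⊟ B) j ≡ colSum A j - colSum B j
  colSum-⊟ A B j = trans (colSum-⊞ A (λ i j → - B i j) j) (cong (_+_ (colSum A j)) (begin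
    colSum (λ i j → - B i j) j  ≡⟨ colSum≡sum (λ i j → - B i j) j ⟩
    sum (λ i → - B i j)         ≡⟨ sum-neg (λ i → B i j) ⟩
    - sum (λ i → B i j)         ≡⟨ cong -_ (colSum≡sum B j) ⟨
    - colSum B j                ∎))
    where open ≡-Reasoning

  ∣S-⊞ : ∀ (A B : Array n) i j → ((A ⊞ B) ∣S) i j ≡ (A ∣S) i j + (B ∣S) i j
  ∣S-⊞ A B i j with inS? i j
  ... | true  = refl
  ... | false = refl

  sSum-⊞ : ∀ (A B : Array n) → sSum (A ⊞ B) ≡ sSum A + sSum B
  sSum-⊞ A B = begin
    sSum (A ⊞ B)
      ≡⟨ sSum≡sum (A ⊞ B) ⟩
    sum (λ i → sum (((A ⊞ B) ∣S) i))
      ≡⟨ sum-cong-≗ (λ i → trans (sum-cong-≗ (∣S-⊞ A B i)) (∑-distrib-+ ((A ∣S) i) ((B ∣S) i))) ⟩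
    sum (λ i → sum ((A ∣S) i) + sum ((B ∣S) i))
      ≡⟨ ∑-distrib-+ (λ i → sum ((A ∣S) i)) (λ i → sum ((B ∣S) i)) ⟩
    sum (λ i → sum ((A ∣S) i)) + sum (λ i → sum ((B ∣S) i))
      ≡⟨ sym (cong₂ _+_ (sSum≡sum A) (sSum≡sum B)) ⟩
    sSum A + sSum B ∎
    where open ≡-Reasoning

  IsMove : Array n → Set
  IsMove D = (∀ i → rowSum D i ≡ 0ℤ) × (∀ j → colSum D j ≡ 0ℤ) × (sSum D ≡ 0ℤ)

  isMove-zeroA : IsMove zeroA
  isMove-zeroA =
    (λ i → trans (rowSum≡sum zeroA i) (sum-replicate-zero (suc n))) ,
    (λ j → trans (colSum≡sum zeroA j) (sum-replicate-zero n)) ,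
    trans (sSum≡sum zeroA) (trans (sum-cong-≗ zero-rows) (sum-replicate-zero n))
    where
    zeroA∣S : ∀ i j → (zeroA ∣S) i j ≡ 0ℤ
    zeroA∣S i j with inS? i j
    ... | true  = refl
    ... | false = refl
    zero-rows : ∀ i → sum ((zeroA ∣S) i) ≡ 0ℤ
    zero-rows i = trans (sum-cong-≗ (zeroA∣S i)) (sum-replicate-zero (suc n))

  isMove-⊞ : {A B : Array n} → IsMove A → IsMove B → IsMove (A ⊞ B)
  isMove-⊞ {A} {B} (rowsA , colsA , sA) (rowsB , colsB , sB) =
    (λ i → trans (rowSum-⊞ A B i) (cong₂ _+_ (rowsA i) (rowsB i))) ,
    (λ j → trans (colSum-⊞ A B j) (cong₂ _+_ (colsA j) (colsB j))) ,
    trans (sSum-⊞ A B) (cong₂ _+_ sA sB)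

  -- B(i,i';j,j') = (e_i - e_i')(e_j - e_j')ᵀ, so every sum of it is computed by ∑-Δ*.
  moveArray-rank1 : ∀ (i i' : Fin n) (j j' : Fin (suc n)) (i≢i' : i ≢ i') (j≢j' : j ≢ j') a b →
    moveArray (bm i i' j j' i≢i' j≢j') a b ≡ Δ i i' a * Δ j j' b
  moveArray-rank1 i i' j j' i≢i' j≢j' a b with a ≟ i | a ≟ i' | b ≟ j | b ≟ j'
  ... | yes refl | yes refl | _        | _        = ⊥-elim (i≢i' refl)
  ... | _        | _        | yes refl | yes refl = ⊥-elim (j≢j' refl)
  ... | yes _ | no _  | yes _ | no _  = refl
  ... | yes _ | no _  | no _  | yes _ = refl
  ... | yes _ | no _  | no _  | no _  = refl
  ... | no _  | yes _ | yes _ | no _  = refl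
  ... | no _  | yes _ | no _  | yes _ = refl
  ... | no _  | yes _ | no _  | no _  = refl
  ... | no _  | no _  | _     | _     = refl

  isMove-basic : ∀ (B : BasicMove n) → InB0 B → IsMove (moveArray B)
  isMove-basic B@(bm i i' j j' i≢i' j≢j') B∈B₀ = rows , cols , B∈B₀
    where
    open ≡-Reasoning
    rows : ∀ a → rowSum (moveArray B) a ≡ 0ℤ
    rows a = begin
      rowSum (moveArray B) a             ≡⟨ rowSum≡sum (moveArray B) a ⟩
      sum (moveArray B a)                ≡⟨ sum-cong-≗ (moveArray-rank1 i i' j j' i≢i' j≢j' a) ⟩
      sum (λ b → Δ i i' a * Δ j j' b)    ≡⟨ *-distribˡ-sum (Δ i i' a) (Δ j j') ⟨
      Δ i i' a * sum (Δ j j')            ≡⟨ cong (Δ i i' a *_) (∑-Δ j j') ⟩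
      Δ i i' a * 0ℤ                      ≡⟨ ℤ.*-zeroʳ (Δ i i' a) ⟩
      0ℤ                                 ∎
    cols : ∀ b → colSum (moveArray B) b ≡ 0ℤ
    cols b = begin
      colSum (moveArray B) b             ≡⟨ colSum≡sum (moveArray B) b ⟩
      sum (λ a → moveArray B a b)        ≡⟨ sum-cong-≗ (λ a → moveArray-rank1 i i' j j' i≢i' j≢j' a b) ⟩
      sum (λ a → Δ i i' a * Δ j j' b)    ≡⟨ ∑-Δ* i i' (λ _ → Δ j j' b) ⟩
      Δ j j' b - Δ j j' b                ≡⟨ ℤ.+-inverseʳ (Δ j j' b) ⟩
      0ℤ                                 ∎

  isMove-sumMoves : ∀ {Bs : List (BasicMove n)} → All InB0 Bs → IsMove (sumMoves Bs)
  isMove-sumMoves         []             = isMove-zeroA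
  isMove-sumMoves {B ∷ _} (B∈B₀ ∷ Bs∈B₀) = isMove-⊞ (isMove-basic B B∈B₀) (isMove-sumMoves Bs∈B₀)

  χ : Bool → ℤ
  χ t = if t then 1ℤ else 0ℤ

  χS : Fin n → Fin (suc n) → ℤ
  χS i j = χ (inS? i j)

  basicMove-∈B₀ : ∀ (i i' : Fin n) (j j' : Fin (suc n)) (i≢i' : i ≢ i') (j≢j' : j ≢ j') →
    inS? i j ≡ inS? i' j → inS? i j' ≡ inS? i' j' → InB0 (bm i i' j j' i≢i' j≢j')
  basicMove-∈B₀ i i' j j' i≢i' j≢j' uniform-j uniform-j' = begin
    sSum M
      ≡⟨ sSum≡sum M ⟩
    sum (λ a → sum ((M ∣S) a))
      ≡⟨ sum-cong-≗ (λ a → sum-cong-≗ (λ b → masked a b)) ⟩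
    sum (λ a → sum (λ b → Δ i i' a * (Δ j j' b * χS a b)))
      ≡⟨ sum-cong-≗ (λ a → sym (*-distribˡ-sum (Δ i i' a) (λ b → Δ j j' b * χS a b))) ⟩
    sum (λ a → Δ i i' a * sum (λ b → Δ j j' b * χS a b))
      ≡⟨ sum-cong-≗ (λ a → cong (Δ i i' a *_) (∑-Δ* j j' (χS a))) ⟩
    sum (λ a → Δ i i' a * (χS a j - χS a j'))
      ≡⟨ ∑-Δ* i i' (λ a → χS a j - χS a j') ⟩
    (χS i j - χS i j') - (χS i' j - χS i' j')
      ≡⟨ cong₂ (λ s t → (χS i j - χS i j') - (s - t)) (cong χ uniform-j) (cong χ uniform-j') ⟨
    (χS i j - χS i j') - (χS i j - χS i j')
      ≡⟨ ℤ.+-inverseʳ (χS i j - χS i j') ⟩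
    0ℤ ∎
    where
    open ≡-Reasoning
    M : Array n
    M = moveArray (bm i i' j j' i≢i' j≢j')
    masked : ∀ a b → (M ∣S) a b ≡ Δ i i' a * (Δ j j' b * χS a b)
    masked a b with inS? a b
    ... | true  = trans (moveArray-rank1 i i' j j' i≢i' j≢j' a b)
                        (cong (Δ i i' a *_) (sym (ℤ.*-identityʳ (Δ j j' b))))
    ... | false = sym (trans (cong (Δ i i' a *_) (ℤ.*-zeroʳ (Δ j j' b))) (ℤ.*-zeroʳ (Δ i i' a)))

  inFiberOf-⊞ : ∀ (X : Table n) {D : Array n} → IsMove D → (∀ i j → 0ℤ ≤ℤ + X i j + D i j) →
    InFiberOf X (toArray X ⊞ D)
  inFiberOf-⊞ X {D} (rowsD , colsD , sD) X+D≥0 = T , T≗X+D , rows , cols , sums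
    where
    T : Table n
    T i j = ∣ + X i j + D i j ∣
    T≗X+D : ∀ i j → toArray T i j ≡ (toArray X ⊞ D) i j
    T≗X+D i j = ℤ.0≤i⇒+∣i∣≡i (X+D≥0 i j)
    rows : ∀ i → rowSum (toArray X) i ≡ rowSum (toArray T) i
    rows i = sym (trans (rowSum-cong T≗X+D i) (trans (rowSum-⊞ (toArray X) D i)
                   (trans (cong (_+_ (rowSum (toArray X) i)) (rowsD i)) (ℤ.+-identityʳ _))))
    cols : ∀ j → colSum (toArray X) j ≡ colSum (toArray T) j
    cols j = sym (trans (colSum-cong T≗X+D j) (trans (colSum-⊞ (toArray X) D j)
                   (trans (cong (_+_ (colSum (toArray X) j)) (colsD j)) (ℤ.+-identityʳ _))))
    sums : sSum (toArray X) ≡ sSum (toArray T)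
    sums = sym (trans (sSum-cong T≗X+D) (trans (sSum-⊞ (toArray X) D)
                 (trans (cong (_+_ (sSum (toArray X))) sD) (ℤ.+-identityʳ _))))

  +norm1≡sum : ∀ (A : Array n) → + norm1 A ≡ sum (λ i → sum (λ j → + ∣ A i j ∣))
  +norm1≡sum A = trans (+Σℕ≡sum n _) (sum-cong-≗ (λ i → +Σℕ≡sum (suc n) (λ j → ∣ A i j ∣)))

  norm1-< : ∀ (W Z D : Array n) → (∀ i → rowSum D i ≡ 0ℤ) →
    (∀ i j → + ∣ W i j ∣ ≤ℤ + ∣ Z i j ∣ + D i j) →
    ∀ i₀ j₀ → + ∣ W i₀ j₀ ∣ <ℤ + ∣ Z i₀ j₀ ∣ + D i₀ j₀ → norm1 W ℕ.< norm1 Z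
  norm1-< W Z D rowsD W≤Z+D i₀ j₀ W<Z+D = ℤ.drop‿+<+ (begin-strict
    + norm1 W
      ≡⟨ +norm1≡sum W ⟩
    sum (λ i → sum (λ j → + ∣ W i j ∣))
      <⟨ ∑-mono-< (λ i → ∑-mono-≤ (W≤Z+D i)) i₀ (∑-mono-< (W≤Z+D i₀) j₀ W<Z+D) ⟩
    sum (λ i → sum (λ j → + ∣ Z i j ∣ + D i j))
      ≡⟨ sum-cong-≗ (λ i → ∑-distrib-+ (λ j → + ∣ Z i j ∣) (D i)) ⟩
    sum (λ i → sum (λ j → + ∣ Z i j ∣) + sum (D i))
      ≡⟨ sum-cong-≗ (λ i → trans (cong (_+_ (sum (λ j → + ∣ Z i j ∣)))
                                       (trans (sym (rowSum≡sum D i)) (rowsD i)))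
                                 (ℤ.+-identityʳ _)) ⟩
    sum (λ i → sum (λ j → + ∣ Z i j ∣))
      ≡⟨ +norm1≡sum Z ⟨
    + norm1 Z ∎)
    where open ℤ.≤-Reasoning

  data MoveEntry (i i' : Fin n) (j j' : Fin (suc n)) (a : Fin n) (b : Fin (suc n)) : ℤ → Set where
    positive  : MoveEntry i i' j j' a b 1ℤ
    negative  : (a ≡ i × b ≡ j') ⊎ (a ≡ i' × b ≡ j) → MoveEntry i i' j j' a b -1ℤ
    vanishing : MoveEntry i i' j j' a b 0ℤ

  moveEntry : ∀ (i i' : Fin n) (j j' : Fin (suc n)) (i≢i' : i ≢ i') (j≢j' : j ≢ j') a b →
    MoveEntry i i' j j' a b (moveArray (bm i i' j j' i≢i' j≢j') a b)
  moveEntry i i' j j' i≢i' j≢j' a b rewrite moveArray-rank1 i i' j j' i≢i' j≢j' a b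
    with Δ i i' a | Δ-value i≢i' a | Δ j j' b | Δ-value j≢j' b
  ... | _ | first _     | _ | first _     = positive
  ... | _ | first refl  | _ | second refl = negative (inj₁ (refl , refl))
  ... | _ | second refl | _ | first refl  = negative (inj₂ (refl , refl))
  ... | _ | second _    | _ | second _    = positive
  ... | _ | first _     | _ | other       = vanishing
  ... | _ | second _    | _ | other       = vanishing
  ... | _ | other       | _ | _           = vanishing

  reducible-by-move : ∀ (X Y : Table n) {p q : Fin n} {a b : Fin (suc n)} (p≢q : p ≢ q) (b≢a : b ≢ a) →
    inS? p a ≡ inS? q a → inS? p b ≡ inS? q b →
    0ℤ <ℤ (toArray X ⊟ toArray Y) p a → (toArray X ⊟ toArray Y) p b <ℤ 0ℤ →
    0ℤ <ℤ (toArray X ⊟ toArray Y) q b → Reducible X Y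
  reducible-by-move X Y {p} {q} {a} {b} p≢q b≢a uniform-a uniform-b Zpa>0 Zpb<0 Zqb>0 =
    B ∷ [] , [] , ℕ.s≤s ℕ.z≤n , B∈B₀ ∷ [] , [] , fiber⁺ , fiber⁻ , norm-decreases
    where
    Z : Array n
    Z = toArray X ⊟ toArray Y
    B : BasicMove n
    B = bm p q b a p≢q b≢a
    M : Array n
    M = moveArray B
    B∈B₀ : InB0 B
    B∈B₀ = basicMove-∈B₀ p q b a p≢q b≢a uniform-b uniform-a
    sumMoves-[B]≗M : ∀ x y → sumMoves (B ∷ []) x y ≡ M x y
    sumMoves-[B]≗M x y = ℤ.+-identityʳ (M x y)

    X+M≥0 : ∀ x y → 0ℤ ≤ℤ + X x y + M x y
    X+M≥0 x y with M x y | moveEntry p q b a p≢q b≢a x y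
    ... | _ | positive                      = +≤+ ℕ.z≤n
    ... | _ | negative (inj₁ (refl , refl)) = 0<x-y⇒0≤x-1 (X p a) (Y p a) Zpa>0
    ... | _ | negative (inj₂ (refl , refl)) = 0<x-y⇒0≤x-1 (X q b) (Y q b) Zqb>0
    ... | _ | vanishing                     = +≤+ ℕ.z≤n

    fiber⁺ : ∀ k → 1 ℕ.≤ k → k ℕ.≤ 1 → InFiberOf X (toArray X ⊞ sumMoves (take k (B ∷ [])))
    fiber⁺ 1 _ _ = inFiberOf-⊞ X (isMove-sumMoves {B ∷ []} (B∈B₀ ∷ []))
      (λ x y → subst (λ m → 0ℤ ≤ℤ + X x y + m) (sym (sumMoves-[B]≗M x y)) (X+M≥0 x y))
    fiber⁺ (suc (suc _)) _ (ℕ.s≤s ())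

    fiber⁻ : ∀ k → 1 ℕ.≤ k → k ℕ.≤ 0 → InFiberOf X (toArray Y ⊟ sumMoves (take k []))
    fiber⁻ (suc _) _ ()

    ∣Z+M∣≤∣Z∣+M : ∀ x y → + ∣ Z x y + M x y ∣ ≤ℤ + ∣ Z x y ∣ + M x y
    ∣Z+M∣≤∣Z∣+M x y with M x y | moveEntry p q b a p≢q b≢a x y
    ... | _ | positive                      = ∣i+1∣≤∣i∣+1 (Z x y)
    ... | _ | negative (inj₁ (refl , refl)) = ℤ.≤-reflexive (0<i⇒∣i-1∣≡∣i∣-1 Zpa>0)
    ... | _ | negative (inj₂ (refl , refl)) = ℤ.≤-reflexive (0<i⇒∣i-1∣≡∣i∣-1 Zqb>0)
    ... | _ | vanishing                     = ℤ.≤-reflexive (∣i+0∣≡∣i∣+0 (Z x y))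

    ∣Z+M∣<∣Z∣+M : + ∣ Z p b + M p b ∣ <ℤ + ∣ Z p b ∣ + M p b
    ∣Z+M∣<∣Z∣+M = subst (λ m → + ∣ Z p b + m ∣ <ℤ + ∣ Z p b ∣ + m) (sym Mpb≡1) (i<0⇒∣i+1∣<∣i∣+1 Zpb<0)
      where
      Mpb≡1 : M p b ≡ 1ℤ
      Mpb≡1 = trans (moveArray-rank1 p q b a p≢q b≢a p b) (cong₂ _*_ (Δ-first p≢q) (Δ-first b≢a))

    W : Array n
    W = (Z ⊞ sumMoves (B ∷ [])) ⊞ sumMoves []
    W≗Z+M : ∀ x y → W x y ≡ Z x y + M x y
    W≗Z+M x y = trans (ℤ.+-identityʳ _) (cong (_+_ (Z x y)) (sumMoves-[B]≗M x y))

    norm-decreases : norm1 W ℕ.< norm1 Z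
    norm-decreases = norm1-< W Z M (proj₁ (isMove-basic B B∈B₀))
      (λ x y → subst (λ w → + ∣ w ∣ ≤ℤ + ∣ Z x y ∣ + M x y) (sym (W≗Z+M x y)) (∣Z+M∣≤∣Z∣+M x y))
      p b (subst (λ w → + ∣ w ∣ <ℤ + ∣ Z p b ∣ + M p b) (sym (W≗Z+M p b)) ∣Z+M∣<∣Z∣+M)

  UniformInS : Fin (suc n) → Set
  UniformInS j = ∀ x x' → inS? x j ≡ inS? x' j

  reducible-by-row : ∀ (X Y : Table n) → SameFiber X Y → {p : Fin n} {a b : Fin (suc n)} → b ≢ a →
    UniformInS a → UniformInS b →
    0ℤ <ℤ (toArray X ⊟ toArray Y) p a → (toArray X ⊟ toArray Y) p b <ℤ 0ℤ → Reducible X Y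
  reducible-by-row X Y (_ , same-cols , _) {p} {a} {b} b≢a uniform-a uniform-b Zpa>0 Zpb<0
    with ∃-positive-of-∑≡0 (λ x → Z x b) column-balanced p Zpb<0
    where
    Z : Array n
    Z = toArray X ⊟ toArray Y
    column-balanced : sum (λ x → Z x b) ≡ 0ℤ
    column-balanced = begin
      sum (λ x → Z x b)                            ≡⟨ colSum≡sum Z b ⟨
      colSum Z b                                   ≡⟨ colSum-⊟ (toArray X) (toArray Y) b ⟩
      colSum (toArray X) b - colSum (toArray Y) b  ≡⟨ cong (_- colSum (toArray Y) b) (same-cols b) ⟩
      colSum (toArray Y) b - colSum (toArray Y) b  ≡⟨ ℤ.+-inverseʳ (colSum (toArray Y) b) ⟩
      0ℤ                                           ∎
      where open ≡-Reasoning
  ... | q , Zqb>0 = reducible-by-move X Y p≢q b≢a (uniform-a p q) (uniform-b p q) Zpa>0 Zpb<0 Zqb>0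
    where
    p≢q : p ≢ q
    p≢q refl = ℤ.<-asym Zpb<0 Zqb>0

  first-column-uniform : UniformInS fzero
  first-column-uniform x x' = trans (inS?-fzero x) (sym (inS?-fzero x'))
    where
    inS?-fzero : ∀ x → inS? x fzero ≡ true
    inS?-fzero x = dec-true (toℕ x ℕ.+ 0 ℕ.<? n) (subst (ℕ._< n) (sym (ℕ.+-identityʳ (toℕ x))) (toℕ<n x))

  last-column-uniform : UniformInS (fromℕ n)
  last-column-uniform x x' = trans (inS?-last x) (sym (inS?-last x'))
    where
    inS?-last : ∀ x → inS? x (fromℕ n) ≡ false
    inS?-last x = dec-false (toℕ x ℕ.+ toℕ (fromℕ n) ℕ.<? n) λ x+n<n →
      ℕ.<⇒≱ (subst (λ k → toℕ x ℕ.+ k ℕ.< n) (toℕ-fromℕ n) x+n<n) (ℕ.m≤n+m n (toℕ x))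

fzero≢fromℕ : ∀ {n} → Fin n → fzero ≢ fromℕ n
fzero≢fromℕ {suc n} _ ()

lemma4 : (n : ℕ) → 2 ≤ n → (X Y : Table n) →
    ¬ (∀ i j → X i j ≡ Y i j) →
    SameFiber X Y →
    Σ (Fin n) (λ ia →
      ((+ 0 <ℤ (toArray X ⊟ toArray Y) ia fzero) × ((toArray X ⊟ toArray Y) ia (fromℕ n) <ℤ + 0)) ⊎
      (((toArray X ⊟ toArray Y) ia fzero <ℤ + 0) × (+ 0 <ℤ (toArray X ⊟ toArray Y) ia (fromℕ n)))) →
    Reducible X Y
lemma4 n _ X Y _ same (ia , inj₁ (Z₁>0 , Zₙ₊₁<0)) =
  reducible-by-row X Y same (fzero≢fromℕ ia ∘ sym) first-column-uniform last-column-uniform Z₁>0 Zₙ₊₁<0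
lemma4 n _ X Y _ same (ia , inj₂ (Z₁<0 , Zₙ₊₁>0)) =
  reducible-by-row X Y same (fzero≢fromℕ ia) last-column-uniform first-column-uniform Zₙ₊₁>0 Z₁<0
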